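{- Let $G$ be a connected bipartite graph with at least two vertices and size parameter $(m,n)$. Then for every positive integer $p$, the number of surjective homomorphisms from $G$ to $K_{1,p}$ equals $s(m,p) + s(n,p)$.
   Context: All graphs are finite, simple and undirected. A surjective homomorphism $G\to H$ is a homomorphism whose vertex map is onto $V(H)$. $K_{1,p}$ is the complete bipartite graph with parts of sizes $1$ and $p$. For positive integers $a,b$, $s(a,b)$ denotes the number of surjections from $\{1,\dots,a\}$ onto $\{1,\dots,b\}$ (zero if $b>a$). The size parameter of a connected bipartite graph with at least two vertices is the pair $(m,n)$ of positive integers with $m\le n$ such that the two parts of its bipartition have $m$ and $n$ vertices respectively. -}

module Defs where

open import Data.Nat using (ℕ; zero; suc; _≤_)
open import Data.Bool using (Bool; true; false; T; not)
open import Data.Bool.Properties using (T?) renaming (_≟_ to _B≟_)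
open import Data.Fin using (Fin; zero; suc)
open import Data.Fin.Properties using (all?; any?; _≟_)
open import Data.Vec using (Vec; []; _∷_; lookup)
open import Data.List using (List; []; _∷_; [_]; length; filter; allFin; cartesianProductWith)
open import Data.Product using (∃; _×_; _,_)
open import Relation.Nullary using (Dec; ¬_)
open import Relation.Nullary.Decidable using (_→-dec_; _×-dec_)
open import Relation.Binary.PropositionalEquality using (_≡_)

record Graph : Set where
  field
    N     : ℕ
    adj   : Fin N → Fin N → Bool
    sym   : ∀ u v → adj u v ≡ adj v u
    irrefl : ∀ u → adj u u ≡ false
open Graph public

data Reachable (G : Graph) : Fin (N G) → Fin (N G) → Set where
  here : ∀ {u} → Reachable G u u
  step : ∀ {u w v} → T (adj G u w) → Reachable G w v → Reachable G u v

Connected : Graph → Set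
Connected G = ∀ u v → Reachable G u v

Proper2Colouring : (G : Graph) → (Fin (N G) → Bool) → Set
Proper2Colouring G c = ∀ u v → T (adj G u v) → c u ≡ not (c v)

countColour : ∀ {N} → (Fin N → Bool) → Bool → ℕ
countColour {N} c b = length (filter (λ x → c x B≟ b) (allFin N))

-- Maps Fin a → Fin b represented as vectors (lookup f x = image of x).
allMaps : ∀ (a b : ℕ) → List (Vec (Fin b) a)
allMaps zero    b = [ [] ]
allMaps (suc a) b = cartesianProductWith _∷_ (allFin b) (allMaps a b)

IsSurjective : ∀ {a b} → Vec (Fin b) a → Set
IsSurjective {a} {b} f = ∀ (y : Fin b) → ∃ λ (x : Fin a) → lookup f x ≡ y

isSurjective? : ∀ {a b} (f : Vec (Fin b) a) → Dec (IsSurjective f)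
isSurjective? f = all? (λ y → any? (λ x → lookup f x ≟ y))

surj : ℕ → ℕ → ℕ
surj a b = length (filter isSurjective? (allMaps a b))

IsHom : (G H : Graph) → Vec (Fin (N H)) (N G) → Set
IsHom G H f = ∀ u v → T (adj G u v) → T (adj H (lookup f u) (lookup f v))

isHom? : ∀ G H (f : Vec (Fin (N H)) (N G)) → Dec (IsHom G H f)
isHom? G H f = all? (λ u → all? (λ v → T? (adj G u v) →-dec T? (adj H (lookup f u) (lookup f v))))

IsSurjHom : (G H : Graph) → Vec (Fin (N H)) (N G) → Set
IsSurjHom G H f = IsHom G H f × IsSurjective f

surjHomCount : Graph → Graph → ℕ
surjHomCount G H = length (filter (λ f → isHom? G H f ×-dec isSurjective? f) (allMaps (N G) (N H)))

-- The star K_{1,p}: vertex zero is the centre, adjacent to the p leaves suc i.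
starAdj : ∀ {p} → Fin (suc p) → Fin (suc p) → Bool
starAdj zero    zero    = false
starAdj zero    (suc _) = true
starAdj (suc _) zero    = true
starAdj (suc _) (suc _) = false

starSym : ∀ {p} (u v : Fin (suc p)) → starAdj u v ≡ starAdj v u
starSym zero    zero    = Relation.Binary.PropositionalEquality.refl
starSym zero    (suc _) = Relation.Binary.PropositionalEquality.refl
starSym (suc _) zero    = Relation.Binary.PropositionalEquality.refl
starSym (suc _) (suc _) = Relation.Binary.PropositionalEquality.refl

starIrrefl : ∀ {p} (u : Fin (suc p)) → starAdj u u ≡ false
starIrrefl zero    = Relation.Binary.PropositionalEquality.refl
starIrrefl (suc _) = Relation.Binary.PropositionalEquality.refl

K1 : ℕ → Graph
K1 p = record { N = suc p ; adj = starAdj ; sym = starSym ; irrefl = starIrrefl }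

{-# OPTIONS --safe #-}

-- Colour each vertex by whether a homomorphism f : G → K_{1,p} sends it to a leaf. Since every edge
-- of the star joins the centre to a leaf, this is a proper 2-colouring, so on a connected G it is the
-- given bipartition or its complement: one colour class goes to the centre, the other to the leaves.
-- Conversely every such map is a homomorphism, surjective exactly when it hits every leaf (the centre
-- is hit because both classes are non-empty). Maps sending a fixed class to the centre correspond to
-- maps from the other class to the p leaves, and this correspondence preserves surjectivity onto the
-- leaves, giving s(m,p) + s(n,p).

module Submission where

open import Defs hiding (sym)
open import Level using (Level; 0ℓ)
open import Function using (_∘_; id; _⇔_; mk⇔; Equivalence)
open import Data.Nat using (ℕ; _+_; _≤_; zero; suc; s≤s)
open import Data.Nat.Properties using (+-suc)
open import Data.Bool using (Bool; true; false; T; not)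
open import Data.Bool.Properties using (not-injective; not-¬; ¬-not) renaming (_≟_ to _B≟_)
open import Data.Fin using (Fin; zero; suc)
open import Data.Fin.Properties using (all?; any?; _≟_; suc-injective)
open import Data.Vec as Vec using (Vec; []; _∷_; lookup; count)
open import Data.Vec.Properties
  using (≡-dec; ∷-injective; lookup-map; lookup∘tabulate; tabulate∘lookup; tabulate-cong)
open import Data.List as List using (List; []; _∷_; _++_; length; filter; allFin; cartesianProductWith)
open import Data.List.Properties
  using (filter-++; filter-≐; filter-all; filter-none; length-map; map-++; map-∘; map-tabulate; ++-identityʳ)
open import Data.List.Relation.Unary.All using (universal)
open import Data.List.Relation.Unary.All.Properties using (tabulate⁺)
open import Data.Product as Product using (∃; ∃₂; _×_; _,_; proj₁; proj₂)
open import Data.Sum using (_⊎_; inj₁; inj₂)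
open import Data.Unit using (tt)
open import Data.Empty using (⊥-elim)
open import Relation.Nullary using (yes; no)
open import Relation.Nullary.Decidable using (T?)
open import Relation.Unary using (Pred; Decidable; _⊥_; _≐_; _⊆_; _∪_; _∩_)
open import Relation.Unary.Properties using (_∪?_; _∩?_)
open import Relation.Binary.PropositionalEquality
  using (_≡_; _≢_; _≗_; refl; sym; trans; cong; cong₂; module ≡-Reasoning)

open ≡-Reasoning

private
  variable
    a a′ b b′ c d ℓ ℓ₁ ℓ₂ ℓ₃ : Level
    A : Set a
    A′ : Set a′
    B : Set b
    B′ : Set b′
    C : Set c
    D : Set d

module _ {P : Pred B ℓ} (P? : Decidable P) (f : A → B) where

  filter-map : filter P? ∘ List.map f ≗ List.map f ∘ filter (P? ∘ f)
  filter-map []       = refl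
  filter-map (x ∷ xs) with P? (f x)
  ... | yes _ = cong (f x ∷_) (filter-map xs)
  ... | no _  = filter-map xs

module _ {P : Pred A ℓ₁} {Q : Pred A ℓ₂} (P? : Decidable P) (Q? : Decidable Q) where

  filter-∩ : filter (P? ∩? Q?) ≗ filter Q? ∘ filter P?
  filter-∩ []       = refl
  filter-∩ (x ∷ xs) with P? x
  ... | no _  = filter-∩ xs
  ... | yes _ with Q? x
  ...   | yes _ = cong (x ∷_) (filter-∩ xs)
  ...   | no _  = filter-∩ xs

  length-filter-∪ : P ⊥ Q → ∀ xs →
                    length (filter (P? ∪? Q?) xs) ≡ length (filter P? xs) + length (filter Q? xs)
  length-filter-∪ disjoint []       = refl
  length-filter-∪ disjoint (x ∷ xs) with P? x | Q? x
  ... | yes px | yes qx = ⊥-elim (disjoint (px , qx))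
  ... | yes _  | no _   = cong suc (length-filter-∪ disjoint xs)
  ... | no _   | yes _  = trans (cong suc (length-filter-∪ disjoint xs)) (sym (+-suc _ _))
  ... | no _   | no _   = length-filter-∪ disjoint xs

module _ {P : Pred A ℓ₁} {Q : Pred B ℓ₂} {R : Pred C ℓ₃}
         (P? : Decidable P) (Q? : Decidable Q) (R? : Decidable R) {f : A → B → C}
         (R⇒P×Q : ∀ {x y} → R (f x y) → P x × Q y)
         (P×Q⇒R : ∀ {x y} → P x → Q y → R (f x y)) where

  filter-cartesianProductWith : ∀ xs ys →
    filter R? (cartesianProductWith f xs ys) ≡ cartesianProductWith f (filter P? xs) (filter Q? ys)
  filter-cartesianProductWith []       ys = refl
  filter-cartesianProductWith (x ∷ xs) ys = begin
    filter R? (List.map (f x) ys ++ cartesianProductWith f xs ys)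
      ≡⟨ filter-++ R? (List.map (f x) ys) _ ⟩
    filter R? (List.map (f x) ys) ++ filter R? (cartesianProductWith f xs ys)
      ≡⟨ cong₂ _++_ (filter-map R? (f x) ys) (filter-cartesianProductWith xs ys) ⟩
    List.map (f x) (filter (R? ∘ f x) ys) ++ cartesianProductWith f (filter P? xs) (filter Q? ys)
      ≡⟨ firstRow ⟩
    cartesianProductWith f (filter P? (x ∷ xs)) (filter Q? ys) ∎
    where
    firstRow : List.map (f x) (filter (R? ∘ f x) ys) ++ cartesianProductWith f (filter P? xs) (filter Q? ys)
             ≡ cartesianProductWith f (filter P? (x ∷ xs)) (filter Q? ys)
    firstRow with P? x
    ... | yes px = cong (λ zs → List.map (f x) zs ++ _)
                        (filter-≐ (R? ∘ f x) Q? (proj₂ ∘ R⇒P×Q , P×Q⇒R px) ys)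
    ... | no ¬px = cong (λ zs → List.map (f x) zs ++ _)
                        (filter-none (R? ∘ f x) (universal (λ _ → ¬px ∘ proj₁ ∘ R⇒P×Q) ys))

cartesianProductWith-map : (f : A → B → C) (g : A′ → A) (h : B′ → B) → ∀ xs ys →
  cartesianProductWith f (List.map g xs) (List.map h ys) ≡ cartesianProductWith (λ x y → f (g x) (h y)) xs ys
cartesianProductWith-map f g h []       ys = refl
cartesianProductWith-map f g h (x ∷ xs) ys =
  cong₂ _++_ (sym (map-∘ ys)) (cartesianProductWith-map f g h xs ys)

map-cartesianProductWith : (k : C → D) (f : A → B → C) → ∀ xs ys →
  List.map k (cartesianProductWith f xs ys) ≡ cartesianProductWith (λ x y → k (f x y)) xs ys
map-cartesianProductWith k f []       ys = refl
map-cartesianProductWith k f (x ∷ xs) ys = begin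
  List.map k (List.map (f x) ys ++ cartesianProductWith f xs ys)
    ≡⟨ map-++ k (List.map (f x) ys) _ ⟩
  List.map k (List.map (f x) ys) ++ List.map k (cartesianProductWith f xs ys)
    ≡⟨ cong₂ _++_ (sym (map-∘ ys)) (map-cartesianProductWith k f xs ys) ⟩
  List.map (k ∘ f x) ys ++ cartesianProductWith (λ x y → k (f x y)) xs ys ∎

isLeaf : ∀ {p} → Fin (suc p) → Bool
isLeaf zero    = false
isLeaf (suc _) = true

isLeaf-false : ∀ {p} {y : Fin (suc p)} → isLeaf y ≡ false → y ≡ zero
isLeaf-false {y = zero} _ = refl

LeafPattern : ∀ {N p} → Vec Bool N → Pred (Vec (Fin (suc p)) N) 0ℓ
LeafPattern ds f = Vec.map isLeaf f ≡ ds

leafPattern? : ∀ {N p} (ds : Vec Bool N) → Decidable (LeafPattern {p = p} ds)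
leafPattern? ds f = ≡-dec _B≟_ (Vec.map isLeaf f) ds

CoversLeaves : ∀ {N p} → Pred (Vec (Fin (suc p)) N) 0ℓ
CoversLeaves {p = p} f = ∀ (y : Fin p) → ∃ λ x → lookup f x ≡ suc y

coversLeaves? : ∀ {N p} → Decidable (CoversLeaves {N} {p})
coversLeaves? f = all? λ y → any? λ x → lookup f x ≟ suc y

placeLeaves : ∀ {N p} (ds : Vec Bool N) → Vec (Fin p) (count T? ds) → Vec (Fin (suc p)) N
placeLeaves []           []      = []
placeLeaves (false ∷ ds) g       = zero ∷ placeLeaves ds g
placeLeaves (true ∷ ds)  (y ∷ g) = suc y ∷ placeLeaves ds g

placeLeaves-hits⁺ : ∀ {N p} (ds : Vec Bool N) (g : Vec (Fin p) (count T? ds)) {y} →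
                    (∃ λ j → lookup g j ≡ y) → ∃ λ x → lookup (placeLeaves ds g) x ≡ suc y
placeLeaves-hits⁺ []           []      (() , _)
placeLeaves-hits⁺ (false ∷ ds) g       hit           = Product.map suc id (placeLeaves-hits⁺ ds g hit)
placeLeaves-hits⁺ (true ∷ ds)  (_ ∷ g) (zero , refl) = zero , refl
placeLeaves-hits⁺ (true ∷ ds)  (_ ∷ g) (suc j , e)   = Product.map suc id (placeLeaves-hits⁺ ds g (j , e))

placeLeaves-hits⁻ : ∀ {N p} (ds : Vec Bool N) (g : Vec (Fin p) (count T? ds)) {y} →
                    (∃ λ x → lookup (placeLeaves ds g) x ≡ suc y) → ∃ λ j → lookup g j ≡ y
placeLeaves-hits⁻ []           []      (() , _)
placeLeaves-hits⁻ (false ∷ ds) g       (zero , ())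
placeLeaves-hits⁻ (false ∷ ds) g       (suc x , e) = placeLeaves-hits⁻ ds g (x , e)
placeLeaves-hits⁻ (true ∷ ds)  (_ ∷ g) (zero , e)  = zero , suc-injective e
placeLeaves-hits⁻ (true ∷ ds)  (_ ∷ g) (suc x , e) = Product.map suc id (placeLeaves-hits⁻ ds g (x , e))

coversLeaves∘placeLeaves≐isSurjective : ∀ {N p} (ds : Vec Bool N) →
  (CoversLeaves ∘ placeLeaves {p = p} ds) ≐ IsSurjective
coversLeaves∘placeLeaves≐isSurjective ds =
  (λ covers y → placeLeaves-hits⁻ ds _ (covers y)) , (λ onto y → placeLeaves-hits⁺ ds _ (onto y))

isLeaf≡? : ∀ {p} (b : Bool) → Decidable (λ (y : Fin (suc p)) → isLeaf y ≡ b)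
isLeaf≡? b y = isLeaf y B≟ b

cartesianProduct-placeLeaves : ∀ {N p} b (ds : Vec Bool N) →
  cartesianProductWith _∷_ (filter (isLeaf≡? b) (allFin (suc p)))
                           (List.map (placeLeaves ds) (allMaps (count T? ds) p))
  ≡ List.map (placeLeaves (b ∷ ds)) (allMaps (count T? (b ∷ ds)) p)
cartesianProduct-placeLeaves {p = p} false ds = begin
  cartesianProductWith _∷_ (filter (isLeaf≡? false) (allFin (suc p))) hs
    ≡⟨⟩
  List.map (zero ∷_) hs ++ cartesianProductWith _∷_ (filter (isLeaf≡? false) (List.tabulate {n = p} suc)) hs
    ≡⟨ cong (λ ys → List.map (zero ∷_) hs ++ cartesianProductWith _∷_ ys hs)
            (filter-none (isLeaf≡? false) (tabulate⁺ {f = suc} λ _ ())) ⟩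
  List.map (zero ∷_) hs ++ []
    ≡⟨ ++-identityʳ _ ⟩
  List.map (zero ∷_) (List.map (placeLeaves ds) gs)
    ≡⟨ map-∘ gs ⟨
  List.map (placeLeaves (false ∷ ds)) gs ∎
  where
  gs = allMaps (count T? ds) p
  hs = List.map (placeLeaves ds) gs
cartesianProduct-placeLeaves {p = p} true ds = begin
  cartesianProductWith _∷_ (filter (isLeaf≡? true) (allFin (suc p))) hs
    ≡⟨ cong (λ ys → cartesianProductWith _∷_ ys hs)
            (filter-all (isLeaf≡? true) (tabulate⁺ {f = suc} λ _ → refl)) ⟩
  cartesianProductWith _∷_ (List.tabulate suc) hs
    ≡⟨ cong (λ ys → cartesianProductWith _∷_ ys hs) (map-tabulate id suc) ⟨
  cartesianProductWith _∷_ (List.map suc (allFin p)) (List.map (placeLeaves ds) gs)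
    ≡⟨ cartesianProductWith-map _∷_ suc (placeLeaves ds) (allFin p) gs ⟩
  cartesianProductWith (λ y g → suc y ∷ placeLeaves ds g) (allFin p) gs
    ≡⟨ map-cartesianProductWith (placeLeaves (true ∷ ds)) _∷_ (allFin p) gs ⟨
  List.map (placeLeaves (true ∷ ds)) (allMaps (suc (count T? ds)) p) ∎
  where
  gs = allMaps (count T? ds) p
  hs = List.map (placeLeaves ds) gs

filter-leafPattern-allMaps : ∀ {N p} (ds : Vec Bool N) →
  filter (leafPattern? ds) (allMaps N (suc p)) ≡ List.map (placeLeaves ds) (allMaps (count T? ds) p)
filter-leafPattern-allMaps                 []       = refl
filter-leafPattern-allMaps {suc N} {p} (b ∷ ds) = begin
  filter (leafPattern? (b ∷ ds)) (cartesianProductWith _∷_ (allFin (suc p)) fs)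
    ≡⟨ filter-cartesianProductWith (isLeaf≡? b) (leafPattern? ds) (leafPattern? (b ∷ ds))
                                   ∷-injective (cong₂ _∷_) (allFin (suc p)) fs ⟩
  cartesianProductWith _∷_ ys (filter (leafPattern? ds) fs)
    ≡⟨ cong (cartesianProductWith _∷_ ys) (filter-leafPattern-allMaps ds) ⟩
  cartesianProductWith _∷_ ys (List.map (placeLeaves ds) (allMaps (count T? ds) p))
    ≡⟨ cartesianProduct-placeLeaves b ds ⟩
  List.map (placeLeaves (b ∷ ds)) (allMaps (count T? (b ∷ ds)) p) ∎
  where
  fs = allMaps N (suc p)
  ys = filter (isLeaf≡? b) (allFin (suc p))

length-filter-leafPattern∩coversLeaves : ∀ {N p} (ds : Vec Bool N) →
  length (filter (leafPattern? ds ∩? coversLeaves?) (allMaps N (suc p))) ≡ surj (count T? ds) p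
length-filter-leafPattern∩coversLeaves {N} {p} ds = begin
  length (filter (leafPattern? ds ∩? coversLeaves?) (allMaps N (suc p)))
    ≡⟨ cong length (filter-∩ (leafPattern? ds) coversLeaves? (allMaps N (suc p))) ⟩
  length (filter coversLeaves? (filter (leafPattern? ds) (allMaps N (suc p))))
    ≡⟨ cong (length ∘ filter coversLeaves?) (filter-leafPattern-allMaps ds) ⟩
  length (filter coversLeaves? (List.map (placeLeaves ds) gs))
    ≡⟨ cong length (filter-map coversLeaves? (placeLeaves ds) gs) ⟩
  length (List.map (placeLeaves ds) (filter (coversLeaves? ∘ placeLeaves ds) gs))
    ≡⟨ length-map (placeLeaves ds) (filter (coversLeaves? ∘ placeLeaves ds) gs) ⟩
  length (filter (coversLeaves? ∘ placeLeaves ds) gs)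
    ≡⟨ cong length (filter-≐ (coversLeaves? ∘ placeLeaves ds) isSurjective?
                             (coversLeaves∘placeLeaves≐isSurjective ds) gs) ⟩
  surj (count T? ds) p ∎
  where gs = allMaps (count T? ds) p

starAdj⇔isLeaf≡not : ∀ {p} (y z : Fin (suc p)) → T (starAdj y z) ⇔ (isLeaf y ≡ not (isLeaf z))
starAdj⇔isLeaf≡not zero    zero    = mk⇔ (λ ()) (λ ())
starAdj⇔isLeaf≡not zero    (suc _) = mk⇔ (λ _ → refl) (λ _ → tt)
starAdj⇔isLeaf≡not (suc _) zero    = mk⇔ (λ _ → refl) (λ _ → tt)
starAdj⇔isLeaf≡not (suc _) (suc _) = mk⇔ (λ ()) (λ ())

isHom⇔leafColouring : ∀ (G : Graph) {p} (f : Vec (Fin (suc p)) (N G)) →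
                      IsHom G (K1 p) f ⇔ Proper2Colouring G (isLeaf ∘ lookup f)
isHom⇔leafColouring G f = mk⇔
  (λ hom u v uv → Equivalence.to   (starAdj⇔isLeaf≡not (lookup f u) (lookup f v)) (hom u v uv))
  (λ col u v uv → Equivalence.from (starAdj⇔isLeaf≡not (lookup f u) (lookup f v)) (col u v uv))

leafPattern-tabulate⇔ : ∀ {N p} (f : Vec (Fin (suc p)) N) (d : Fin N → Bool) →
                        LeafPattern (Vec.tabulate d) f ⇔ (∀ x → isLeaf (lookup f x) ≡ d x)
leafPattern-tabulate⇔ f d = mk⇔
  (λ leaves≡ds x → begin
    isLeaf (lookup f x)             ≡⟨ lookup-map x isLeaf f ⟨
    lookup (Vec.map isLeaf f) x     ≡⟨ cong (λ v → lookup v x) leaves≡ds ⟩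
    lookup (Vec.tabulate d) x       ≡⟨ lookup∘tabulate d x ⟩
    d x                             ∎)
  (λ leaf≡d → begin
    Vec.map isLeaf f                         ≡⟨ tabulate∘lookup (Vec.map isLeaf f) ⟨
    Vec.tabulate (lookup (Vec.map isLeaf f))
      ≡⟨ tabulate-cong (λ x → trans (lookup-map x isLeaf f) (leaf≡d x)) ⟩
    Vec.tabulate d                           ∎)

LeafLayout : ∀ {N p} → (Fin N → Bool) → Pred (Vec (Fin (suc p)) N) 0ℓ
LeafLayout d = LeafPattern (Vec.tabulate d) ∩ CoversLeaves

leafLayout? : ∀ {N p} (d : Fin N → Bool) → Decidable (LeafLayout {p = p} d)
leafLayout? d = leafPattern? (Vec.tabulate d) ∩? coversLeaves?

module _ {G : Graph} where

  proper-cong : ∀ {c d} → c ≗ d → Proper2Colouring G c → Proper2Colouring G d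
  proper-cong c≗d proper u v uv = trans (sym (c≗d u)) (trans (proper u v uv) (cong not (c≗d v)))

  proper-not : ∀ {c} → Proper2Colouring G c → Proper2Colouring G (not ∘ c)
  proper-not proper u v uv = cong not (proper u v uv)

  proper-agree-along : ∀ {c d} → Proper2Colouring G c → Proper2Colouring G d →
                       ∀ {u v} → Reachable G u v → c u ≡ d u → c v ≡ d v
  proper-agree-along pc pd here                cu≡du = cu≡du
  proper-agree-along pc pd (step {u} {w} uw r) cu≡du =
    proper-agree-along pc pd r (not-injective (trans (sym (pc u w uw)) (trans cu≡du (pd u w uw))))

  connected-proper-unique : ∀ {c d} → Connected G → Proper2Colouring G c → Proper2Colouring G d →
                            Fin (N G) → (d ≗ c) ⊎ (d ≗ not ∘ c)
  connected-proper-unique {c} {d} connected pc pd u with d u B≟ c u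
  ... | yes du≡cu = inj₁ λ x → proper-agree-along pd pc (connected u x) du≡cu
  ... | no  du≢cu = inj₂ λ x → proper-agree-along pd (proper-not pc) (connected u x) (¬-not du≢cu)

  proper-surjective : ∀ {c u v} → Proper2Colouring G c → T (adj G u v) → ∀ b → ∃ λ x → c x ≡ b
  proper-surjective {c} {u} {v} proper uv b with c u B≟ b
  ... | yes cu≡b = u , cu≡b
  ... | no  cu≢b = v , not-injective (trans (sym (proper u v uv)) (¬-not cu≢b))

  connected⇒edge : Connected G → 2 ≤ N G → ∃₂ λ u v → T (adj G u v)
  connected⇒edge connected 2≤N = let u , v , u≢v = distinct 2≤N in edgeOn (connected u v) u≢v
    where
    distinct : ∀ {k} → 2 ≤ k → ∃₂ λ (u v : Fin k) → u ≢ v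
    distinct (s≤s (s≤s _)) = zero , suc zero , λ ()
    edgeOn : ∀ {u v} → Reachable G u v → u ≢ v → ∃₂ λ u v → T (adj G u v)
    edgeOn here        u≢u = ⊥-elim (u≢u refl)
    edgeOn (step uw _) _   = _ , _ , uw

  module _ {p : ℕ} where

    surjHom⊆leafLayouts : ∀ {c} → Connected G → Proper2Colouring G c →
                          IsSurjHom G (K1 p) ⊆ LeafLayout (not ∘ c) ∪ LeafLayout c
    surjHom⊆leafLayouts {c} connected proper {f} (hom , onto)
      with connected-proper-unique connected proper (Equivalence.to (isHom⇔leafColouring G f) hom)
                                   (proj₁ (onto zero))
    ... | inj₁ leaf≗c  = inj₂ (Equivalence.from (leafPattern-tabulate⇔ f c) leaf≗c , onto ∘ suc)
    ... | inj₂ leaf≗¬c = inj₁ (Equivalence.from (leafPattern-tabulate⇔ f (not ∘ c)) leaf≗¬c , onto ∘ suc)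

    leafLayout⊆surjHom : ∀ {d} → Proper2Colouring G d → (∃ λ x → d x ≡ false) →
                         LeafLayout d ⊆ IsSurjHom G (K1 p)
    leafLayout⊆surjHom {d} proper (x , dx≡false) {f} (leaves≡d , covers) = hom , onto
      where
      leaf≗d : isLeaf ∘ lookup f ≗ d
      leaf≗d = Equivalence.to (leafPattern-tabulate⇔ f d) leaves≡d
      hom : IsHom G (K1 p) f
      hom = Equivalence.from (isHom⇔leafColouring G f) (proper-cong (λ x → sym (leaf≗d x)) proper)
      onto : IsSurjective f
      onto zero    = x , isLeaf-false (trans (leaf≗d x) dx≡false)
      onto (suc y) = covers y

    leafLayouts-disjoint : ∀ {c} → Fin (N G) → LeafLayout {p = p} (not ∘ c) ⊥ LeafLayout c
    leafLayouts-disjoint {c} x {f} ((leaves≡¬c , _) , (leaves≡c , _)) =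
      not-¬ refl (trans (sym (Equivalence.to (leafPattern-tabulate⇔ f c) leaves≡c x))
                        (Equivalence.to (leafPattern-tabulate⇔ f (not ∘ c)) leaves≡¬c x))

    surjHomCount-leafLayouts : ∀ {c} → Connected G → 2 ≤ N G → Proper2Colouring G c →
      surjHomCount G (K1 p) ≡ length (filter (leafLayout? (not ∘ c)) (allMaps (N G) (suc p)))
                            + length (filter (leafLayout? c) (allMaps (N G) (suc p)))
    surjHomCount-leafLayouts {c} connected 2≤N proper = begin
      surjHomCount G (K1 p)
        ≡⟨ cong length (filter-≐ _ (leafLayout? (not ∘ c) ∪? leafLayout? c)
                                 (surjHom⊆leafLayouts connected proper , ⊇) maps) ⟩
      length (filter (leafLayout? (not ∘ c) ∪? leafLayout? c) maps)
        ≡⟨ length-filter-∪ (leafLayout? (not ∘ c)) (leafLayout? c) (leafLayouts-disjoint u) maps ⟩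
      length (filter (leafLayout? (not ∘ c)) maps) + length (filter (leafLayout? c) maps) ∎
      where
      maps = allMaps (N G) (suc p)
      edge = connected⇒edge connected 2≤N
      u = proj₁ edge
      uv = proj₂ (proj₂ edge)
      ⊇ : LeafLayout (not ∘ c) ∪ LeafLayout c ⊆ IsSurjHom G (K1 p)
      ⊇ (inj₁ layout) =
        leafLayout⊆surjHom (proper-not proper) (proper-surjective (proper-not proper) uv false) layout
      ⊇ (inj₂ layout) =
        leafLayout⊆surjHom proper (proper-surjective proper uv false) layout

countColour-true : ∀ {N} (c : Fin N → Bool) → countColour c true ≡ count T? (Vec.tabulate c)
countColour-true c = length-filter-tabulate c id
  where
  length-filter-tabulate : ∀ {M N} (c : Fin M → Bool) (g : Fin N → Fin M) →
       length (filter (λ x → c x B≟ true) (List.tabulate g)) ≡ count T? (Vec.tabulate (c ∘ g))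
  length-filter-tabulate {N = zero}  c g = refl
  length-filter-tabulate {N = suc N} c g with c (g zero)
  ... | true  = cong suc (length-filter-tabulate c (g ∘ suc))
  ... | false = length-filter-tabulate c (g ∘ suc)

countColour-false : ∀ {N} (c : Fin N → Bool) → countColour c false ≡ count T? (Vec.tabulate (not ∘ c))
countColour-false {N} c = begin
  countColour c false
    ≡⟨ cong length (filter-≐ (λ x → c x B≟ false) (λ x → not (c x) B≟ true)
                             (cong not , not-injective) (allFin N)) ⟩
  countColour (not ∘ c) true
    ≡⟨ countColour-true (not ∘ c) ⟩
  count T? (Vec.tabulate (not ∘ c)) ∎

lemma5 : (G : Graph) → Connected G → 2 ≤ N G →
         (c : Fin (N G) → Bool) → Proper2Colouring G c →
         (m n : ℕ) → countColour c false ≡ m → countColour c true ≡ n → m ≤ n →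
         (p : ℕ) → 1 ≤ p →
         surjHomCount G (K1 p) ≡ surj m p + surj n p
lemma5 G connected 2≤N c proper m n false≡m true≡n _ p _ = begin
  surjHomCount G (K1 p)
    ≡⟨ surjHomCount-leafLayouts connected 2≤N proper ⟩
  length (filter (leafLayout? (not ∘ c)) maps) + length (filter (leafLayout? c) maps)
    ≡⟨ cong₂ _+_ (length-filter-leafPattern∩coversLeaves (Vec.tabulate (not ∘ c)))
                 (length-filter-leafPattern∩coversLeaves (Vec.tabulate c)) ⟩
  surj (count T? (Vec.tabulate (not ∘ c))) p + surj (count T? (Vec.tabulate c)) p
    ≡⟨ cong₂ (λ k l → surj k p + surj l p) (trans (sym (countColour-false c)) false≡m)
                                            (trans (sym (countColour-true c)) true≡n) ⟩
  surj m p + surj n p ∎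
  where maps = allMaps (N G) (suc p)
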